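{- Consider an instance of deadline-scheduling-with-processor-bounds with integer bounds $0 \le l_t \le m_t \le m$ for $t\in T$. Build the flow network with source $\alpha$, sink $\omega$, an auxiliary node $\gamma$, a node $u_j$ for every job $j \in J$ and a node $v_t$ for every $t \in T$, and arcs: $\alpha \to u_j$ of capacity $p_j$; $u_j \to v_t$ of capacity $1$ if $t \in E_j$ and $0$ otherwise; $v_t \to \gamma$ of capacity $m_t - l_t$; $v_t \to \omega$ of capacity $l_t$; and $\gamma \to \omega$ of capacity $P - \sum_{t \in T} l_t$, where $P = \sum_{j\in J} p_j$. Then the instance has a feasible solution if and only if the maximum $\alpha$-$\omega$ flow in this network has value $P$.
   Context: There are $m \ge 1$ processors and a set $J$ of jobs; each job $j$ has integer release time $r_j$, deadline $d_j$ and processing volume $p_j$; time slots are $T=\{0,\dots,d\}$ with $d$ the latest deadline, and $E_j = \{t\in T: r_j \le t \le d_j\}$. A feasible schedule assigns to each processor and time slot at most one job such that each job $j$ occupies exactly $p_j$ distinct slots of $E_j$ and is never run on two processors in the same slot. For a schedule, $\mathrm{vol}(t)$ denotes the number of busy processors (equivalently, jobs scheduled) at slot $t$. An instance of deadline-scheduling-with-processor-bounds additionally specifies for each $t \in T$ a lower bound $l_t$ and an upper bound $m_t \le m$; a feasible solution is a feasible schedule with $l_t \le \mathrm{vol}(t) \le m_t$ for every $t \in T$. -}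

module Defs where

open import Data.Nat as ℕ using (ℕ; zero; suc)
open import Data.Integer as ℤ using (ℤ; +_; 0ℤ)
open import Data.Fin using (Fin; toℕ)
open import Data.List using (List; _∷_; []; map; _++_; foldr; allFin)
open import Data.Nat.ListAction using (sum)
open import Data.Maybe using (Maybe; just; nothing)
open import Data.Bool using (Bool; true; false; if_then_else_)
open import Data.Product using (Σ; ∃; _×_; _,_)
open import Relation.Nullary using (¬_; Dec; yes; no; ¬?)
open import Data.Sum using (_⊎_)
open import Relation.Nullary.Decidable using (⌊_⌋; _×-dec_)
open import Relation.Binary.PropositionalEquality using (_≡_)
import Data.Fin.Properties as FinP
open import Data.Maybe.Properties using (≡-dec)

-- n jobs (J = Fin n), m processors, time slots T = Fin (suc d) = {0,…,d}.
record Instance : Set where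
  field
    m  : ℕ
    n  : ℕ
    d  : ℕ
    r  : Fin n → ℕ
    dl : Fin n → ℕ
    p  : Fin n → ℕ
    l  : Fin (suc d) → ℕ
    mt : Fin (suc d) → ℕ

  T : Set
  T = Fin (suc d)

  InE : Fin n → T → Set
  InE j t = (r j ℕ.≤ toℕ t) × (toℕ t ℕ.≤ dl j)

  inE? : (j : Fin n) (t : T) → Dec (InE j t)
  inE? j t = (r j ℕ.≤? toℕ t) ×-dec (toℕ t ℕ.≤? dl j)

WellFormed : Instance → Set
WellFormed I = (∀ j → dl j ℕ.≤ d) × (∃ λ j → dl j ≡ d)
             × (∀ t → l t ℕ.≤ mt t) × (∀ t → mt t ℕ.≤ m)
  where open Instance I

count : ∀ {k} {P : Fin k → Set} → ((i : Fin k) → Dec (P i)) → ℕ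
count {k} P? = sum (map (λ i → if ⌊ P? i ⌋ then 1 else 0) (allFin k))

Schedule : Instance → Set
Schedule I = Fin m → T → Maybe (Fin n)
  where open Instance I

module _ (I : Instance) (S : Schedule I) where
  open Instance I

  procs : Fin n → T → ℕ
  procs j t = count (λ i → ≡-dec FinP._≟_ (S i t) (just j))

  runs? : (j : Fin n) (t : T) → Dec (procs j t ≡ 1)
  runs? j t = procs j t ℕ.≟ 1

  vol : T → ℕ
  vol t = count (λ i → ¬? (≡-dec FinP._≟_ (S i t) nothing))

  FeasibleSchedule : Set
  FeasibleSchedule =
      (∀ j t → procs j t ℕ.≤ 1)
    × (∀ j t → procs j t ≡ 1 → InE j t)
    × (∀ j → count (runs? j) ≡ p j)

  FeasibleSolution : Set
  FeasibleSolution = FeasibleSchedule × (∀ t → (l t ℕ.≤ vol t) × (vol t ℕ.≤ mt t))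

HasFeasibleSolution : Instance → Set
HasFeasibleSolution I = Σ (Schedule I) (FeasibleSolution I)

data Node (n d : ℕ) : Set where
  α ω γ : Node n d
  u : Fin n → Node n d
  v : Fin (suc d) → Node n d

allNodes : (n d : ℕ) → List (Node n d)
allNodes n d = α ∷ ω ∷ γ ∷ map u (allFin n) ++ map v (allFin (suc d))

sumℤ : List ℤ → ℤ
sumℤ = foldr ℤ._+_ 0ℤ

Σnodes : ∀ {n d} → (Node n d → ℤ) → ℤ
Σnodes {n} {d} g = sumℤ (map g (allNodes n d))

sumJobs : ∀ {k} → (Fin k → ℕ) → ℕ
sumJobs {k} g = sum (map g (allFin k))

capacity : (I : Instance) → Node (Instance.n I) (Instance.d I)
                          → Node (Instance.n I) (Instance.d I) → ℤ
capacity I α (u j) = + p j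
  where open Instance I
capacity I (u j) (v t) = if ⌊ inE? j t ⌋ then + 1 else + 0
  where open Instance I
capacity I (v t) γ = + mt t ℤ.- + l t
  where open Instance I
capacity I (v t) ω = + l t
  where open Instance I
capacity I γ ω = + sumJobs p ℤ.- + sumJobs l
  where open Instance I
capacity I _ _ = 0ℤ

module _ {n d : ℕ} (cap : Node n d → Node n d → ℤ) where

  IsFlow : (Node n d → Node n d → ℤ) → Set
  IsFlow f =
      (∀ a b → 0ℤ ℤ.≤ f a b)
    × (∀ a b → f a b ℤ.≤ cap a b)
    × (∀ a → a ≡ α ⊎ a ≡ ω ⊎ (Σnodes (λ b → f b a) ≡ Σnodes (λ b → f a b)))

  flowValue : (Node n d → Node n d → ℤ) → ℤ
  flowValue f = Σnodes (λ b → f α b) ℤ.- Σnodes (λ b → f b α)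

  MaxFlowValue : ℤ → Set
  MaxFlowValue val =
      (Σ (Node n d → Node n d → ℤ) λ f → IsFlow f × flowValue f ≡ val)
    × (∀ f → IsFlow f → flowValue f ℤ.≤ val)

-- A feasible solution is the same thing as a 0/1 job–slot matrix x with row sums p_j,
-- support inside the windows E_j and column sums in [l_t, m_t]: the jobs of a column
-- can always be laid out on distinct processors since m_t ≤ m. Such a matrix is an
-- integral flow of value P: x on the arcs u_j → v_t, the saturated arcs v_t → ω
-- carry the lower bounds and the surplus of each column is routed through γ. Conversely
-- a flow of value P saturates every α → u_j, so its total P = Σ_t f(v_t ω) + f(γ ω)
-- together with f(γ ω) ≤ P − Σ_t l_t forces every v_t → ω to carry exactly l_t; the
-- column sums are then l_t + f(v_t γ) ∈ [l_t, m_t].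
module Submission where

open import Defs
open import Data.Nat using (ℕ; zero; suc; _+_; _∸_; _≤_; z≤n; s≤s; _≟_)
open import Data.Nat.Properties
open import Data.Nat.ListAction using () renaming (sum to listSum)
open import Data.Nat.ListAction.Properties using (sum-++)
open import Data.Integer as ℤ using (ℤ; +_; 0ℤ; ∣_∣)
import Data.Integer.Properties as ℤ
open import Data.Fin using (Fin; zero; suc)
import Data.Fin.Properties as Fin
open import Data.List using (List; []; _∷_; map; tabulate; allFin; _++_)
open import Data.List.Properties using (map-++; map-∘; map-cong)
import Data.Vec.Functional as Vector
open import Data.Maybe as Maybe using (Maybe; just; nothing)
open import Data.Maybe.Properties using (≡-dec; just-injective)
open import Data.Bool using (if_then_else_)
open import Data.Product using (Σ-syntax; _×_; _,_; proj₁; proj₂)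
open import Data.Sum as Sum using (_⊎_; inj₁; inj₂)
open import Relation.Nullary using (¬_; Dec; yes; no; ¬?; contradiction)
open import Relation.Nullary.Decidable using (⌊_⌋)
open import Relation.Binary.PropositionalEquality
open import Function using (_∘_)
open import Function.Bundles using (_⇔_; mk⇔)
open import Algebra.Properties.CommutativeMonoid.Sum +-0-commutativeMonoid
  using (∑-comm; ∑-distrib-+; sum-cong-≗; sum-replicate-zero) renaming (sum to ∑)

-- Finite sums of naturals

sum-map-tabulate : ∀ {A : Set} {k} (g : A → ℕ) (h : Fin k → A) →
                   listSum (map g (tabulate h)) ≡ ∑ (g ∘ h)
sum-map-tabulate {k = zero}  g h = refl
sum-map-tabulate {k = suc k} g h = cong (λ s → g (h zero) + s) (sum-map-tabulate g (h ∘ suc))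

sumJobs≡∑ : ∀ {k} (g : Fin k → ℕ) → sumJobs g ≡ ∑ g
sumJobs≡∑ g = sum-map-tabulate g (λ i → i)

∑-zero : ∀ {k} {g : Fin k → ℕ} → (∀ i → g i ≡ 0) → ∑ g ≡ 0
∑-zero {k} g≗0 = trans (sum-cong-≗ g≗0) (sum-replicate-zero k)

∑-mono-≤ : ∀ {k} {g h : Fin k → ℕ} → (∀ i → g i ≤ h i) → ∑ g ≤ ∑ h
∑-mono-≤ {zero}  g≤h = z≤n
∑-mono-≤ {suc k} g≤h = +-mono-≤ (g≤h zero) (∑-mono-≤ (g≤h ∘ suc))

pointwise-≤∧∑-≥⇒≡ : ∀ {k} {g h : Fin k → ℕ} → (∀ i → g i ≤ h i) → ∑ h ≤ ∑ g →
                    ∀ i → g i ≡ h i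
pointwise-≤∧∑-≥⇒≡ {suc k} {g} {h} g≤h ∑h≤∑g zero = ≤-antisym (g≤h zero)
  (+-cancelʳ-≤ _ _ _ (≤-trans ∑h≤∑g (+-monoʳ-≤ (g zero) (∑-mono-≤ (g≤h ∘ suc)))))
pointwise-≤∧∑-≥⇒≡ {suc k} {g} {h} g≤h ∑h≤∑g (suc i) =
  pointwise-≤∧∑-≥⇒≡ (g≤h ∘ suc)
    (+-cancelˡ-≤ (h zero) _ _ (≤-trans ∑h≤∑g (+-monoˡ-≤ _ (g≤h zero)))) i

∑-∸ : ∀ {k} {g h : Fin k → ℕ} → (∀ i → h i ≤ g i) →
      ∑ (λ i → g i ∸ h i) ≡ ∑ g ∸ ∑ h
∑-∸ {g = g} {h} h≤g = begin
  ∑ (λ i → g i ∸ h i)                 ≡⟨ m+n∸n≡m _ (∑ h) ⟨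
  ∑ (λ i → g i ∸ h i) + ∑ h ∸ ∑ h     ≡⟨ cong (_∸ ∑ h) (∑-distrib-+ (λ i → g i ∸ h i) h) ⟨
  ∑ (λ i → g i ∸ h i + h i) ∸ ∑ h     ≡⟨ cong (_∸ ∑ h) (sum-cong-≗ (m∸n+n≡m ∘ h≤g)) ⟩
  ∑ g ∸ ∑ h                           ∎
  where open ≡-Reasoning

-- Indicators and occupancy of processors

indicator : ∀ {P : Set} → Dec P → ℕ
indicator P? = if ⌊ P? ⌋ then 1 else 0

indicator-no : ∀ {P : Set} (P? : Dec P) → ¬ P → indicator P? ≡ 0
indicator-no (yes p) ¬p = contradiction p ¬p
indicator-no (no _)  ¬p = refl

indicator-cong : ∀ {P Q : Set} (P? : Dec P) (Q? : Dec Q) → (P → Q) → (Q → P) →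
                 indicator P? ≡ indicator Q?
indicator-cong (yes p) (yes q) P→Q Q→P = refl
indicator-cong (yes p) (no ¬q) P→Q Q→P = contradiction (P→Q p) ¬q
indicator-cong (no ¬p) (yes q) P→Q Q→P = contradiction (Q→P q) ¬p
indicator-cong (no ¬p) (no ¬q) P→Q Q→P = refl

indicator-≟1 : ∀ {x} → x ≤ 1 → indicator (x ≟ 1) ≡ x
indicator-≟1 z≤n       = refl
indicator-≟1 (s≤s z≤n) = refl

count≡∑ : ∀ {k} {P : Fin k → Set} (P? : ∀ i → Dec (P i)) → count P? ≡ ∑ (indicator ∘ P?)
count≡∑ P? = sum-map-tabulate (indicator ∘ P?) (λ i → i)

module _ {n : ℕ} where

  holds : Maybe (Fin n) → Fin n → ℕ
  holds x j = indicator (≡-dec Fin._≟_ x (just j))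

  busy : Maybe (Fin n) → ℕ
  busy x = indicator (¬? (≡-dec Fin._≟_ x nothing))

  occupancy : ∀ {k} → (Fin k → Maybe (Fin n)) → Fin n → ℕ
  occupancy σ j = ∑ (λ i → holds (σ i) j)

shift : ∀ {n k} → (Fin k → Maybe (Fin n)) → Fin k → Maybe (Fin (suc n))
shift σ = Maybe.map suc ∘ σ

holds-shift-zero : ∀ {n} (x : Maybe (Fin n)) → holds (Maybe.map suc x) zero ≡ 0
holds-shift-zero nothing  = refl
holds-shift-zero (just _) = refl

holds-shift-suc : ∀ {n} (x : Maybe (Fin n)) j → holds (Maybe.map suc x) (suc j) ≡ holds x j
holds-shift-suc nothing  j = refl
holds-shift-suc (just k) j =
  indicator-cong (≡-dec Fin._≟_ (just (suc k)) (just (suc j))) (≡-dec Fin._≟_ (just k) (just j))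
    (cong just ∘ Fin.suc-injective ∘ just-injective) (cong (just ∘ suc) ∘ just-injective)

∑-holds-just : ∀ {n} (k : Fin n) → ∑ (holds (just k)) ≡ 1
∑-holds-just {suc n} zero    =
  cong suc (∑-zero {n} (λ j → indicator-no (≡-dec Fin._≟_ (just zero) (just (suc j))) λ ()))
∑-holds-just {suc n} (suc k) =
  trans (sum-cong-≗ (holds-shift-suc (just k))) (∑-holds-just k)

busy≡∑holds : ∀ {n} (x : Maybe (Fin n)) → busy x ≡ ∑ (holds x)
busy≡∑holds {n} nothing  =
  sym (∑-zero {n} (λ j → indicator-no (≡-dec Fin._≟_ nothing (just j)) λ ()))
busy≡∑holds     (just k) = sym (∑-holds-just k)

occupancy-shift-zero : ∀ {n k} (σ : Fin k → Maybe (Fin n)) → occupancy (shift σ) zero ≡ 0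
occupancy-shift-zero σ = ∑-zero (holds-shift-zero ∘ σ)

occupancy-shift-suc : ∀ {n k} (σ : Fin k → Maybe (Fin n)) j →
                      occupancy (shift σ) (suc j) ≡ occupancy σ j
occupancy-shift-suc σ j = sum-cong-≗ (λ i → holds-shift-suc (σ i) j)

occupancy-shift : ∀ {n k} {σ : Fin k → Maybe (Fin n)} {x : Fin (suc n) → ℕ} →
                  x zero ≡ 0 → occupancy σ ≗ x ∘ suc → occupancy (shift σ) ≗ x
occupancy-shift {σ = σ} x₀≡0 occ zero    = trans (occupancy-shift-zero σ) (sym x₀≡0)
occupancy-shift {σ = σ} x₀≡0 occ (suc j) = trans (occupancy-shift-suc σ j) (occ j)

occupancy-push : ∀ {n k} {σ : Fin k → Maybe (Fin n)} {x : Fin (suc n) → ℕ} →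
                 x zero ≡ 1 → occupancy σ ≗ x ∘ suc → occupancy (just zero Vector.∷ shift σ) ≗ x
occupancy-push {σ = σ} x₀≡1 occ zero    = trans (cong suc (occupancy-shift-zero σ)) (sym x₀≡1)
occupancy-push {σ = σ} x₀≡1 occ (suc j) = trans (occupancy-shift-suc σ j) (occ j)

fill : ∀ {n} k (x : Fin n → ℕ) → (∀ j → x j ≤ 1) → ∑ x ≤ k →
       Σ[ σ ∈ (Fin k → Maybe (Fin n)) ] occupancy σ ≗ x
fill {zero}  k x x≤1 ∑x≤k = (λ _ → nothing) , λ ()
fill {suc n} k x x≤1 ∑x≤k with n≤1⇒n≡0∨n≡1 (x≤1 zero)
... | inj₁ x₀≡0 =
  let σ , occ = fill k (x ∘ suc) (x≤1 ∘ suc) (≤-trans (m≤n+m _ (x zero)) ∑x≤k)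
  in  shift σ , occupancy-shift {σ = σ} x₀≡0 occ
... | inj₂ x₀≡1 = push (subst (λ x₀ → x₀ + ∑ (x ∘ suc) ≤ k) x₀≡1 ∑x≤k)
  where
  push : ∀ {k} → suc (∑ (x ∘ suc)) ≤ k → Σ[ σ ∈ (Fin k → Maybe (Fin (suc n))) ] occupancy σ ≗ x
  push {suc k} (s≤s ∑x∘suc≤k) =
    let σ , occ = fill k (x ∘ suc) (x≤1 ∘ suc) ∑x∘suc≤k
    in  just zero Vector.∷ shift σ , occupancy-push {σ = σ} x₀≡1 occ

-- Schedules as 0/1 job–slot matrices

module _ (I : Instance) where
  open Instance I

  load : (Fin n → T → ℕ) → T → ℕ
  load x t = ∑ (λ j → x j t)

  record FeasibleAssignment : Set where
    field
      runs     : Fin n → T → ℕ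
      runs≤1   : ∀ j t → runs j t ≤ 1
      runs⇒InE : ∀ j t → runs j t ≡ 1 → InE j t
      ∑runs≡p  : ∀ j → ∑ (runs j) ≡ p j
      l≤load   : ∀ t → l t ≤ load runs t
      load≤mt  : ∀ t → load runs t ≤ mt t

  module _ (S : Schedule I) where

    procs≡occupancy : ∀ j t → procs I S j t ≡ occupancy (λ i → S i t) j
    procs≡occupancy j t = count≡∑ (λ i → ≡-dec Fin._≟_ (S i t) (just j))

    vol≡load : ∀ t → vol I S t ≡ load (procs I S) t
    vol≡load t = begin
      vol I S t                             ≡⟨ count≡∑ (¬? ∘ λ i → ≡-dec Fin._≟_ (S i t) nothing) ⟩
      ∑ (λ i → busy (S i t))                ≡⟨ sum-cong-≗ (λ i → busy≡∑holds (S i t)) ⟩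
      ∑ (λ i → ∑ (holds (S i t)))           ≡⟨ ∑-comm (λ i j → holds (S i t) j) ⟩
      ∑ (λ j → occupancy (λ i → S i t) j)   ≡⟨ sum-cong-≗ (λ j → procs≡occupancy j t) ⟨
      load (procs I S) t                    ∎
      where open ≡-Reasoning

    count-runs : ∀ j → (∀ t → procs I S j t ≤ 1) →
                 count (runs? I S j) ≡ ∑ (λ t → procs I S j t)
    count-runs j procs≤1 = trans (count≡∑ (runs? I S j)) (sum-cong-≗ (indicator-≟1 ∘ procs≤1))

  solution⇒assignment : HasFeasibleSolution I → FeasibleAssignment
  solution⇒assignment (S , (procs≤1 , procs⇒InE , count≡p) , vol-bounds) = record
    { runs     = procs I S
    ; runs≤1   = procs≤1
    ; runs⇒InE = procs⇒InE
    ; ∑runs≡p  = λ j → trans (sym (count-runs S j (procs≤1 j))) (count≡p j)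
    ; l≤load   = λ t → subst (l t ≤_) (vol≡load S t) (proj₁ (vol-bounds t))
    ; load≤mt  = λ t → subst (_≤ mt t) (vol≡load S t) (proj₂ (vol-bounds t))
    }

  assignment⇒solution : (∀ t → mt t ≤ m) → FeasibleAssignment → HasFeasibleSolution I
  assignment⇒solution mt≤m A = S , (procs≤1 , procs⇒InE , count≡p) , vol-bounds
    where
    open FeasibleAssignment A

    column : ∀ t → Σ[ σ ∈ (Fin m → Maybe (Fin n)) ] occupancy σ ≗ λ j → runs j t
    column t = fill m (λ j → runs j t) (λ j → runs≤1 j t) (≤-trans (load≤mt t) (mt≤m t))

    S : Schedule I
    S i t = proj₁ (column t) i

    procs≡runs : ∀ j t → procs I S j t ≡ runs j t
    procs≡runs j t = trans (procs≡occupancy S j t) (proj₂ (column t) j)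

    procs≤1 : ∀ j t → procs I S j t ≤ 1
    procs≤1 j t = subst (_≤ 1) (sym (procs≡runs j t)) (runs≤1 j t)

    procs⇒InE : ∀ j t → procs I S j t ≡ 1 → InE j t
    procs⇒InE j t = runs⇒InE j t ∘ trans (sym (procs≡runs j t))

    count≡p : ∀ j → count (runs? I S j) ≡ p j
    count≡p j = trans (count-runs S j (procs≤1 j)) (trans (sum-cong-≗ (procs≡runs j)) (∑runs≡p j))

    vol≡load-runs : ∀ t → vol I S t ≡ load runs t
    vol≡load-runs t = trans (vol≡load S t) (sum-cong-≗ (λ j → procs≡runs j t))

    vol-bounds : ∀ t → (l t ≤ vol I S t) × (vol I S t ≤ mt t)
    vol-bounds t = subst (l t ≤_) (sym (vol≡load-runs t)) (l≤load t)
                 , subst (_≤ mt t) (sym (vol≡load-runs t)) (load≤mt t)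

-- Integral flows

+m-+n≡+[m∸n] : ∀ {m n} → n ≤ m → + m ℤ.- + n ≡ + (m ∸ n)
+m-+n≡+[m∸n] {m} {n} n≤m = trans (ℤ.m-n≡m⊖n m n) (ℤ.⊖-≥ n≤m)

+k≤+m-+n⇒k+n≤m : ∀ {k m n} → + k ℤ.≤ + m ℤ.- + n → k + n ≤ m
+k≤+m-+n⇒k+n≤m {k} {m} {n} k≤m-n =
  m≤o∸n⇒m+n≤o k n≤m (ℤ.drop‿+≤+ (subst (+ k ℤ.≤_) (+m-+n≡+[m∸n] n≤m) k≤m-n))
  where
  n≤m : n ≤ m
  n≤m = ℤ.drop‿+≤+ (ℤ.0≤i-j⇒j≤i (ℤ.≤-trans (ℤ.+≤+ z≤n) k≤m-n))

k+n≤m⇒+k≤+m-+n : ∀ {k m n} → k + n ≤ m → + k ℤ.≤ + m ℤ.- + n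
k+n≤m⇒+k≤+m-+n {k} {m} {n} k+n≤m =
  subst (+ k ℤ.≤_) (sym (+m-+n≡+[m∸n] (≤-trans (m≤n+m n k) k+n≤m)))
        (ℤ.+≤+ (m+n≤o⇒m≤o∸n k k+n≤m))

sumℤ-map-+ : ∀ {A : Set} (g : A → ℕ) (xs : List A) →
             sumℤ (map (λ a → + g a) xs) ≡ + listSum (map g xs)
sumℤ-map-+ g []       = refl
sumℤ-map-+ g (x ∷ xs) = cong (λ s → + g x ℤ.+ s) (sumℤ-map-+ g xs)

module _ {n d : ℕ} where

  nodeSum : (Node n d → ℕ) → ℕ
  nodeSum g = g α + (g ω + (g γ + (∑ (g ∘ u) + ∑ (g ∘ v))))

  outflow inflow : (Node n d → Node n d → ℕ) → Node n d → ℕ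
  outflow G a = nodeSum (G a)
  inflow  G a = nodeSum (λ b → G b a)

  Σnodes-+ : (g : Node n d → ℕ) → Σnodes (λ b → + g b) ≡ + nodeSum g
  Σnodes-+ g = trans (sumℤ-map-+ g (allNodes n d))
                     (cong (λ s → + (g α + (g ω + (g γ + s)))) jobs+slots)
    where
    sum-map-allFin : ∀ {k} (h : Fin k → Node n d) → listSum (map g (map h (allFin k))) ≡ ∑ (g ∘ h)
    sum-map-allFin {k} h = trans (cong listSum (sym (map-∘ {g = g} {f = h} (allFin k))))
                                 (sum-map-tabulate (g ∘ h) (λ i → i))

    jobs+slots : listSum (map g (map u (allFin n) ++ map v (allFin (suc d)))) ≡ ∑ (g ∘ u) + ∑ (g ∘ v)
    jobs+slots = trans (cong listSum (map-++ g (map u (allFin n)) (map v (allFin (suc d)))))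
                 (trans (sum-++ (map g (map u (allFin n))) _)
                        (cong₂ _+_ (sum-map-allFin u) (sum-map-allFin v)))

  Σnodes-cong : {g h : Node n d → ℤ} → (∀ b → g b ≡ h b) → Σnodes g ≡ Σnodes h
  Σnodes-cong g≗h = cong sumℤ (map-cong g≗h (allNodes n d))

  module _ {cap : Node n d → Node n d → ℤ} where

    isFlow-ℕ : (G : Node n d → Node n d → ℕ) → (∀ a b → + G a b ℤ.≤ cap a b) →
               (∀ a → a ≡ α ⊎ a ≡ ω ⊎ inflow G a ≡ outflow G a) →
               IsFlow cap (λ a b → + G a b)
    isFlow-ℕ G G≤cap conserves =
      (λ a b → ℤ.+≤+ z≤n) , G≤cap , Sum.map₂ (Sum.map₂ conservesℤ) ∘ conserves
      where
      conservesℤ : ∀ {a} → inflow G a ≡ outflow G a →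
                   Σnodes (λ b → + G b a) ≡ Σnodes (λ b → + G a b)
      conservesℤ {a} in≡out =
        trans (Σnodes-+ (λ b → G b a)) (trans (cong +_ in≡out) (sym (Σnodes-+ (G a))))

    module NaturalFlow {f : Node n d → Node n d → ℤ} (isF : IsFlow cap f) where

      F : Node n d → Node n d → ℕ
      F a b = ∣ f a b ∣

      f≡+F : ∀ a b → f a b ≡ + F a b
      f≡+F a b = sym (ℤ.0≤i⇒+∣i∣≡i (proj₁ isF a b))

      F≤cap : ∀ a b → + F a b ℤ.≤ cap a b
      F≤cap a b = subst (ℤ._≤ cap a b) (f≡+F a b) (proj₁ (proj₂ isF) a b)

      Σnodes-out : ∀ a → Σnodes (λ b → f a b) ≡ + outflow F a
      Σnodes-out a = trans (Σnodes-cong (f≡+F a)) (Σnodes-+ (F a))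

      Σnodes-in : ∀ a → Σnodes (λ b → f b a) ≡ + inflow F a
      Σnodes-in a = trans (Σnodes-cong (λ b → f≡+F b a)) (Σnodes-+ (λ b → F b a))

      conservation : ∀ a → a ≢ α → a ≢ ω → inflow F a ≡ outflow F a
      conservation a a≢α a≢ω with proj₂ (proj₂ isF) a
      ... | inj₁ a≡α          = contradiction a≡α a≢α
      ... | inj₂ (inj₁ a≡ω)   = contradiction a≡ω a≢ω
      ... | inj₂ (inj₂ in≡out) = ℤ.+-injective (trans (sym (Σnodes-in a)) (trans in≡out (Σnodes-out a)))

      flowValue≡out-in : flowValue cap f ≡ + outflow F α ℤ.- + inflow F α
      flowValue≡out-in = cong₂ ℤ._-_ (Σnodes-out α) (Σnodes-in α)

-- The network of the instance

module _ (I : Instance) where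
  open Instance I

  module Arcs (G : Node n d → Node n d → ℕ) (G≤cap : ∀ a b → + G a b ℤ.≤ capacity I a b) where

    vanishes : ∀ a b → capacity I a b ≡ 0ℤ → G a b ≡ 0
    vanishes a b cap≡0 = n≤0⇒n≡0 (ℤ.drop‿+≤+ (subst (+ G a b ℤ.≤_) cap≡0 (G≤cap a b)))

    inflow-α : inflow G α ≡ 0
    inflow-α
      rewrite vanishes α α refl | vanishes ω α refl | vanishes γ α refl
            | ∑-zero {n} (λ j → vanishes (u j) α refl)
            | ∑-zero {suc d} (λ t → vanishes (v t) α refl)
      = refl

    outflow-α : outflow G α ≡ ∑ (λ j → G α (u j))
    outflow-α
      rewrite vanishes α α refl | vanishes α ω refl | vanishes α γ refl
            | ∑-zero {suc d} (λ t → vanishes α (v t) refl)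
      = +-identityʳ _

    inflow-u : ∀ j → inflow G (u j) ≡ G α (u j)
    inflow-u j
      rewrite vanishes ω (u j) refl | vanishes γ (u j) refl
            | ∑-zero {n} (λ i → vanishes (u i) (u j) refl)
            | ∑-zero {suc d} (λ t → vanishes (v t) (u j) refl)
      = +-identityʳ _

    outflow-u : ∀ j → outflow G (u j) ≡ ∑ (λ t → G (u j) (v t))
    outflow-u j
      rewrite vanishes (u j) α refl | vanishes (u j) ω refl | vanishes (u j) γ refl
            | ∑-zero {n} (λ i → vanishes (u j) (u i) refl)
      = refl

    inflow-v : ∀ t → inflow G (v t) ≡ ∑ (λ j → G (u j) (v t))
    inflow-v t
      rewrite vanishes α (v t) refl | vanishes ω (v t) refl | vanishes γ (v t) refl
            | ∑-zero {suc d} (λ s → vanishes (v s) (v t) refl)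
      = +-identityʳ _

    outflow-v : ∀ t → outflow G (v t) ≡ G (v t) ω + G (v t) γ
    outflow-v t
      rewrite vanishes (v t) α refl
            | ∑-zero {n} (λ j → vanishes (v t) (u j) refl)
            | ∑-zero {suc d} (λ s → vanishes (v t) (v s) refl)
      = cong (_+_ (G (v t) ω)) (+-identityʳ _)

    inflow-γ : inflow G γ ≡ ∑ (λ t → G (v t) γ)
    inflow-γ
      rewrite vanishes α γ refl | vanishes ω γ refl | vanishes γ γ refl
            | ∑-zero {n} (λ j → vanishes (u j) γ refl)
      = refl

    outflow-γ : outflow G γ ≡ G γ ω
    outflow-γ
      rewrite vanishes γ α refl | vanishes γ γ refl
            | ∑-zero {n} (λ j → vanishes γ (u j) refl)
            | ∑-zero {suc d} (λ t → vanishes γ (v t) refl)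
      = +-identityʳ _

    source≤p : ∀ j → G α (u j) ≤ p j
    source≤p j = ℤ.drop‿+≤+ (G≤cap α (u j))

    job-slot≤1 : ∀ j t → G (u j) (v t) ≤ 1
    job-slot≤1 j t with inE? j t | G≤cap (u j) (v t)
    ... | yes _ | ℤ.+≤+ G≤1 = G≤1
    ... | no _  | ℤ.+≤+ G≤0 = ≤-trans G≤0 z≤n

    job-slot⇒InE : ∀ j t → G (u j) (v t) ≡ 1 → InE j t
    job-slot⇒InE j t G≡1 with inE? j t | G≤cap (u j) (v t)
    ... | yes t∈E | _       = t∈E
    ... | no _    | ℤ.+≤+ G≤0 = contradiction (subst (_≤ 0) G≡1 G≤0) λ ()

    sink≤l : ∀ t → G (v t) ω ≤ l t
    sink≤l t = ℤ.drop‿+≤+ (G≤cap (v t) ω)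

    surplus+l≤mt : ∀ t → G (v t) γ + l t ≤ mt t
    surplus+l≤mt t = +k≤+m-+n⇒k+n≤m (G≤cap (v t) γ)

    γω+sumJobs-l≤sumJobs-p : G γ ω + sumJobs l ≤ sumJobs p
    γω+sumJobs-l≤sumJobs-p = +k≤+m-+n⇒k+n≤m (G≤cap γ ω)

  flowValue≡∑source : ∀ {f} (isF : IsFlow (capacity I) f) →
                      flowValue (capacity I) f ≡ + ∑ (λ j → ∣ f α (u j) ∣)
  flowValue≡∑source {f} isF = begin
    flowValue (capacity I) f                ≡⟨ flowValue≡out-in ⟩
    + outflow F α ℤ.- + inflow F α          ≡⟨ cong₂ (λ o i → + o ℤ.- + i) outflow-α inflow-α ⟩
    + ∑ (λ j → F α (u j)) ℤ.- + 0           ≡⟨ ℤ.+-identityʳ _ ⟩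
    + ∑ (λ j → F α (u j))                   ∎
    where
    open ≡-Reasoning
    open NaturalFlow isF
    open Arcs F F≤cap

  flowValue≤P : ∀ {f} → IsFlow (capacity I) f → flowValue (capacity I) f ℤ.≤ + sumJobs p
  flowValue≤P isF = subst₂ ℤ._≤_ (sym (flowValue≡∑source isF)) (cong +_ (sym (sumJobs≡∑ p)))
                           (ℤ.+≤+ (∑-mono-≤ source≤p))
    where
    open NaturalFlow isF
    open Arcs F F≤cap

  module AssignmentFlow (A : FeasibleAssignment I) where
    open FeasibleAssignment A

    ∑load≡P : ∑ (load I runs) ≡ sumJobs p
    ∑load≡P = trans (sym (∑-comm runs)) (trans (sum-cong-≗ ∑runs≡p) (sym (sumJobs≡∑ p)))

    sumJobs-l≤P : sumJobs l ≤ sumJobs p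
    sumJobs-l≤P = subst₂ _≤_ (sym (sumJobs≡∑ l)) ∑load≡P (∑-mono-≤ l≤load)

    runs-outside-window : ∀ j t → ¬ InE j t → runs j t ≡ 0
    runs-outside-window j t t∉E with n≤1⇒n≡0∨n≡1 (runs≤1 j t)
    ... | inj₁ runs≡0 = runs≡0
    ... | inj₂ runs≡1 = contradiction (runs⇒InE j t runs≡1) t∉E

    G : Node n d → Node n d → ℕ
    G α     (u j) = p j
    G (u j) (v t) = runs j t
    G (v t) γ     = load I runs t ∸ l t
    G (v t) ω     = l t
    G γ     ω     = sumJobs p ∸ sumJobs l
    G _     _     = 0

    G≤cap : ∀ a b → + G a b ℤ.≤ capacity I a b
    G≤cap α     (u j) = ℤ.≤-refl
    G≤cap (u j) (v t) with inE? j t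
    ... | yes _   = ℤ.+≤+ (runs≤1 j t)
    ... | no t∉E  = ℤ.+≤+ (≤-reflexive (runs-outside-window j t t∉E))
    G≤cap (v t) γ     = k+n≤m⇒+k≤+m-+n (≤-trans (≤-reflexive (m∸n+n≡m (l≤load t))) (load≤mt t))
    G≤cap (v t) ω     = ℤ.≤-refl
    G≤cap γ     ω     = k+n≤m⇒+k≤+m-+n (≤-reflexive (m∸n+n≡m sumJobs-l≤P))
    -- G and capacity reduce only on pairs of constructors, hence the listing of absent arcs.
    G≤cap ω     _     = ℤ.≤-refl
    G≤cap α     α     = ℤ.≤-refl
    G≤cap α     ω     = ℤ.≤-refl
    G≤cap α     γ     = ℤ.≤-refl
    G≤cap α     (v _) = ℤ.≤-refl
    G≤cap γ     α     = ℤ.≤-refl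
    G≤cap γ     γ     = ℤ.≤-refl
    G≤cap γ     (u _) = ℤ.≤-refl
    G≤cap γ     (v _) = ℤ.≤-refl
    G≤cap (u _) α     = ℤ.≤-refl
    G≤cap (u _) ω     = ℤ.≤-refl
    G≤cap (u _) γ     = ℤ.≤-refl
    G≤cap (u _) (u _) = ℤ.≤-refl
    G≤cap (v _) α     = ℤ.≤-refl
    G≤cap (v _) (u _) = ℤ.≤-refl
    G≤cap (v _) (v _) = ℤ.≤-refl

    open Arcs G G≤cap
    open ≡-Reasoning

    conserves : ∀ a → a ≡ α ⊎ a ≡ ω ⊎ inflow G a ≡ outflow G a
    conserves α     = inj₁ refl
    conserves ω     = inj₂ (inj₁ refl)
    conserves (u j) = inj₂ (inj₂ (begin
      inflow G (u j)                          ≡⟨ inflow-u j ⟩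
      p j                                     ≡⟨ ∑runs≡p j ⟨
      ∑ (runs j)                              ≡⟨ outflow-u j ⟨
      outflow G (u j)                         ∎))
    conserves (v t) = inj₂ (inj₂ (begin
      inflow G (v t)                          ≡⟨ inflow-v t ⟩
      load I runs t                           ≡⟨ m+[n∸m]≡n (l≤load t) ⟨
      l t + (load I runs t ∸ l t)             ≡⟨ outflow-v t ⟨
      outflow G (v t)                         ∎))
    conserves γ     = inj₂ (inj₂ (begin
      inflow G γ                              ≡⟨ inflow-γ ⟩
      ∑ (λ t → load I runs t ∸ l t)           ≡⟨ ∑-∸ l≤load ⟩
      ∑ (load I runs) ∸ ∑ l                   ≡⟨ cong₂ _∸_ ∑load≡P (sym (sumJobs≡∑ l)) ⟩
      sumJobs p ∸ sumJobs l                   ≡⟨ outflow-γ ⟨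
      outflow G γ                             ∎))

    isFlow : IsFlow (capacity I) (λ a b → + G a b)
    isFlow = isFlow-ℕ G G≤cap conserves

    flowValue≡P : flowValue (capacity I) (λ a b → + G a b) ≡ + sumJobs p
    flowValue≡P = trans (flowValue≡∑source isFlow) (cong +_ (sym (sumJobs≡∑ p)))

  maxFlow⇒assignment : ∀ {f} → IsFlow (capacity I) f → flowValue (capacity I) f ≡ + sumJobs p →
                       FeasibleAssignment I
  maxFlow⇒assignment {f} isF value≡P = record
    { runs     = runs
    ; runs≤1   = job-slot≤1
    ; runs⇒InE = job-slot⇒InE
    ; ∑runs≡p  = ∑runs≡p
    ; l≤load   = λ t → subst (l t ≤_) (sym (load≡l+surplus t)) (m≤m+n (l t) _)
    ; load≤mt  = λ t → subst (_≤ mt t) (trans (+-comm _ (l t)) (sym (load≡l+surplus t)))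
                             (surplus+l≤mt t)
    }
    where
    open NaturalFlow isF
    open Arcs F F≤cap

    runs : Fin n → T → ℕ
    runs j t = F (u j) (v t)

    sink surplus : T → ℕ
    sink    t = F (v t) ω
    surplus t = F (v t) γ

    source-saturated : ∀ j → F α (u j) ≡ p j
    source-saturated = pointwise-≤∧∑-≥⇒≡ source≤p (≤-reflexive (ℤ.+-injective (begin
      + ∑ p                                   ≡⟨ cong +_ (sumJobs≡∑ p) ⟨
      + sumJobs p                             ≡⟨ value≡P ⟨
      flowValue (capacity I) f                ≡⟨ flowValue≡∑source isF ⟩
      + ∑ (λ j → F α (u j))                   ∎)))
      where open ≡-Reasoning

    ∑runs≡p : ∀ j → ∑ (runs j) ≡ p j
    ∑runs≡p j = begin
      ∑ (runs j)                              ≡⟨ outflow-u j ⟨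
      outflow F (u j)                         ≡⟨ conservation (u j) (λ ()) (λ ()) ⟨
      inflow F (u j)                          ≡⟨ inflow-u j ⟩
      F α (u j)                               ≡⟨ source-saturated j ⟩
      p j                                     ∎
      where open ≡-Reasoning

    load≡sink+surplus : ∀ t → load I runs t ≡ sink t + surplus t
    load≡sink+surplus t = begin
      load I runs t                           ≡⟨ inflow-v t ⟨
      inflow F (v t)                          ≡⟨ conservation (v t) (λ ()) (λ ()) ⟩
      outflow F (v t)                         ≡⟨ outflow-v t ⟩
      sink t + surplus t                      ∎
      where open ≡-Reasoning

    ∑p≡∑sink+γω : ∑ p ≡ ∑ sink + F γ ω
    ∑p≡∑sink+γω = begin
      ∑ p                                     ≡⟨ sum-cong-≗ ∑runs≡p ⟨
      ∑ (λ j → ∑ (runs j))                    ≡⟨ ∑-comm runs ⟩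
      ∑ (load I runs)                         ≡⟨ sum-cong-≗ load≡sink+surplus ⟩
      ∑ (λ t → sink t + surplus t)            ≡⟨ ∑-distrib-+ sink surplus ⟩
      ∑ sink + ∑ surplus                      ≡⟨ cong (_+_ (∑ sink)) (sym inflow-γ) ⟩
      ∑ sink + inflow F γ                     ≡⟨ cong (_+_ (∑ sink)) (conservation γ (λ ()) (λ ())) ⟩
      ∑ sink + outflow F γ                    ≡⟨ cong (_+_ (∑ sink)) outflow-γ ⟩
      ∑ sink + F γ ω                          ∎
      where open ≡-Reasoning

    ∑l≤∑sink : ∑ l ≤ ∑ sink
    ∑l≤∑sink = +-cancelˡ-≤ (F γ ω) _ _ (begin
      F γ ω + ∑ l                             ≡⟨ cong (_+_ (F γ ω)) (sumJobs≡∑ l) ⟨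
      F γ ω + sumJobs l                       ≤⟨ γω+sumJobs-l≤sumJobs-p ⟩
      sumJobs p                               ≡⟨ sumJobs≡∑ p ⟩
      ∑ p                                     ≡⟨ ∑p≡∑sink+γω ⟩
      ∑ sink + F γ ω                          ≡⟨ +-comm (∑ sink) (F γ ω) ⟩
      F γ ω + ∑ sink                          ∎)
      where open ≤-Reasoning

    load≡l+surplus : ∀ t → load I runs t ≡ l t + surplus t
    load≡l+surplus t =
      trans (load≡sink+surplus t) (cong (_+ surplus t) (pointwise-≤∧∑-≥⇒≡ sink≤l ∑l≤∑sink t))

lemma2 : (I : Instance) → WellFormed I →
    HasFeasibleSolution I ⇔
      MaxFlowValue (capacity I) (+ sumJobs (Instance.p I))
lemma2 I (_ , _ , _ , mt≤m) = mk⇔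
  (λ solution → let open AssignmentFlow I (solution⇒assignment I solution)
                in  ((λ a b → + G a b) , isFlow , flowValue≡P) , λ _ → flowValue≤P I)
  (λ ((f , isF , value≡P) , _) → assignment⇒solution I mt≤m (maxFlow⇒assignment I isF value≡P))
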